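{- Let $\Sigma=\{\veebar,\wedge,\vee,\mathbin{\dot\vee}\}$ and let $\mathbb{A}$ be a set of $\Phi$-teams. Then there is no $\mathrm{PL}(\Sigma)$-formula $\varphi$ with $\mathrm{wd}(\varphi)<D(\mathbb{A},\mathrm{Tms}(\Phi)\setminus\mathbb{A})$ that defines $\mathbb{A}$ (i.e. such that for every $\Phi$-team $T$: $T\models\varphi$ iff $T\in\mathbb{A}$).
   Context: A $\Phi$-team is a set of maps $\Phi\to\{0,1\}$, $\Phi$ a finite set of variables; $\mathrm{Tms}(\Phi)$ is the set of all $\Phi$-teams. A split of $T$ is $(T_1,T_2)$ with $T_1,T_2\subseteq T$, $T_1\cup T_2=T$; strict if $T_1\cap T_2=\emptyset$. $\mathrm{PL}(\Sigma)$-formulas are built from the literals $\top,\bot,{\sim}\top,{\sim}\bot,p,\neg p,{\sim}p,{\sim}\neg p$ ($p\in\Phi$) by the connectives of $\Sigma$. Semantics: $T\models\top$ always; $T\models\bot$ iff $T=\emptyset$; $T\models p$ iff $s(p)=1$ for all $s\in T$; $T\models\neg p$ iff $s(p)=0$ for all $s\in T$; $T\models{\sim}\ell$ iff $T\not\models\ell$; $\wedge$ conjunction; $T\models\psi\veebar\theta$ iff $T\models\psi$ or $T\models\theta$; $T\models\psi\vee\theta$ iff some split $(S,U)$ has $S\models\psi,U\models\theta$; $\mathbin{\dot\vee}$ likewise with strict splits. Width: $\mathrm{wd}(\ell)=1$ for literals and $\mathrm{wd}(\psi\circ\theta)=\mathrm{wd}(\psi)+\mathrm{wd}(\theta)$.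 A team $T'$ is a neighbour of $T$ if $T'=T\setminus\{s\}$ for some $s\in T$; $N(T,\mathbb{B})$ is the number of neighbours of $T$ in $\mathbb{B}$; $D(\mathbb{A},\mathbb{B})=\max\{N(A,\mathbb{B}):A\in\mathbb{A}\}$. -}

module Defs where

open import Data.Nat using (ℕ; zero; suc; _+_; _⊔_)
open import Data.Bool using (Bool; true; false; _∧_; _∨_; not; if_then_else_)
import Data.Bool.Properties as BoolP
open import Data.Fin using (Fin)
open import Data.Vec using (Vec; []; _∷_; lookup)
open import Data.List using (List; []; _∷_; _++_; map; concatMap; foldr)
open import Data.Bool.ListAction using (any)
open import Data.Nat.ListAction using (sum)
open import Data.Product using (_×_; _,_; Σ; ∃)
import Data.Product.Properties as ProdP
open import Data.Empty using (⊥)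
open import Data.Unit using (⊤)
open import Data.Sum using (_⊎_)
open import Relation.Nullary using (¬_; Dec; yes; no)
open import Relation.Nullary.Decidable using (⌊_⌋)
open import Relation.Binary.PropositionalEquality using (_≡_)

-- Variables Φ = Fin n.  An assignment s : Φ → {0,1} is a vector of Booleans
-- (s(p) = lookup s p, with true = 1).
Assignment : ℕ → Set
Assignment n = Vec Bool n

-- We use a canonical
-- representation (a binary trie = characteristic function), so that
-- propositional equality of teams is equality of sets.
Team : ℕ → Set
Team zero    = Bool                 -- is the empty assignment in the team?
Team (suc n) = Team n × Team n      -- (part with first var = 0 , part with first var = 1)

_∈ᵇ_ : ∀ {n} → Assignment n → Team n → Bool
_∈ᵇ_ {zero}  []          b         = b
_∈ᵇ_ {suc n} (false ∷ s) (T₀ , T₁) = s ∈ᵇ T₀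
_∈ᵇ_ {suc n} (true  ∷ s) (T₀ , T₁) = s ∈ᵇ T₁

_∈ₜ_ : ∀ {n} → Assignment n → Team n → Set
s ∈ₜ T = s ∈ᵇ T ≡ true

_⊆ₜ_ : ∀ {n} → Team n → Team n → Set
T₁ ⊆ₜ T₂ = ∀ s → s ∈ₜ T₁ → s ∈ₜ T₂

IsEmpty : ∀ {n} → Team n → Set
IsEmpty T = ∀ s → ¬ (s ∈ₜ T)

IsSplit : ∀ {n} → Team n → Team n → Team n → Set
IsSplit T T₁ T₂ = T₁ ⊆ₜ T × T₂ ⊆ₜ T × (∀ s → s ∈ₜ T → (s ∈ᵇ T₁ ∨ s ∈ᵇ T₂) ≡ true)

IsStrictSplit : ∀ {n} → Team n → Team n → Team n → Set
IsStrictSplit T T₁ T₂ = IsSplit T T₁ T₂ × (∀ s → ¬ (s ∈ₜ T₁ × s ∈ₜ T₂))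

data Formula (n : ℕ) : Set where
  ⊤ᶠ ⊥ᶠ ∼⊤ᶠ ∼⊥ᶠ     : Formula n
  var neg ∼var ∼neg : Fin n → Formula n
  _⊻ᶠ_ _∧ᶠ_ _∨ᶠ_ _∨̇ᶠ_ : Formula n → Formula n → Formula n

wd : ∀ {n} → Formula n → ℕ
wd (φ ⊻ᶠ ψ) = wd φ + wd ψ
wd (φ ∧ᶠ ψ) = wd φ + wd ψ
wd (φ ∨ᶠ ψ) = wd φ + wd ψ
wd (φ ∨̇ᶠ ψ) = wd φ + wd ψ
wd _        = 1

_⊨_ : ∀ {n} → Team n → Formula n → Set
T ⊨ ⊤ᶠ       = ⊤
T ⊨ ⊥ᶠ       = IsEmpty T
T ⊨ ∼⊤ᶠ      = ⊥
T ⊨ ∼⊥ᶠ      = ¬ IsEmpty T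
T ⊨ var p    = ∀ s → s ∈ₜ T → lookup s p ≡ true
T ⊨ neg p    = ∀ s → s ∈ₜ T → lookup s p ≡ false
T ⊨ ∼var p   = ¬ (∀ s → s ∈ₜ T → lookup s p ≡ true)
T ⊨ ∼neg p   = ¬ (∀ s → s ∈ₜ T → lookup s p ≡ false)
T ⊨ (φ ⊻ᶠ ψ) = (T ⊨ φ) ⊎ (T ⊨ ψ)
T ⊨ (φ ∧ᶠ ψ) = (T ⊨ φ) × (T ⊨ ψ)
T ⊨ (φ ∨ᶠ ψ) = ∃ λ S → ∃ λ U → IsSplit T S U × (S ⊨ φ) × (U ⊨ ψ)
T ⊨ (φ ∨̇ᶠ ψ) = ∃ λ S → ∃ λ U → IsStrictSplit T S U × (S ⊨ φ) × (U ⊨ ψ)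

allAssign : ∀ n → List (Assignment n)
allAssign zero    = [] ∷ []
allAssign (suc n) = map (false ∷_) (allAssign n) ++ map (true ∷_) (allAssign n)

allTeams : ∀ n → List (Team n)
allTeams zero    = false ∷ true ∷ []
allTeams (suc n) = concatMap (λ T₀ → map (λ T₁ → (T₀ , T₁)) (allTeams n)) (allTeams n)

remove : ∀ {n} → Assignment n → Team n → Team n
remove {zero}  []          b         = false
remove {suc n} (false ∷ s) (T₀ , T₁) = (remove s T₀ , T₁)
remove {suc n} (true  ∷ s) (T₀ , T₁) = (T₀ , remove s T₁)

_≟ₜ_ : ∀ {n} (T U : Team n) → Dec (T ≡ U)
_≟ₜ_ {zero}  = BoolP._≟_
_≟ₜ_ {suc n} = ProdP.≡-dec _≟ₜ_ _≟ₜ_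

isNeighbourᵇ : ∀ {n} → Team n → Team n → Bool
isNeighbourᵇ {n} T' T = any (λ s → s ∈ᵇ T ∧ ⌊ T' ≟ₜ remove s T ⌋) (allAssign n)

TeamSet : ℕ → Set
TeamSet n = Team n → Bool

Nb : ∀ {n} → Team n → TeamSet n → ℕ
Nb {n} T 𝔹 = sum (map (λ T' → if isNeighbourᵇ T' T ∧ 𝔹 T' then 1 else 0) (allTeams n))

-- D(𝔸, 𝔹) = max { N(A, 𝔹) : A ∈ 𝔸 }   (0 if 𝔸 = ∅)
D : ∀ {n} → TeamSet n → TeamSet n → ℕ
D {n} 𝔸 𝔹 = foldr _⊔_ 0 (map (λ A → if 𝔸 A then Nb A 𝔹 else 0) (allTeams n))

compl : ∀ {n} → TeamSet n → TeamSet n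
compl 𝔸 T = not (𝔸 T)

Defines : ∀ {n} → Formula n → TeamSet n → Set
Defines φ 𝔸 = ∀ T → ((T ⊨ φ) → 𝔸 T ≡ true) × (𝔸 T ≡ true → T ⊨ φ)

module Submission where

-- Call s ∈ T critical for a team property P if T ∖ {s} no longer has P.  A team
-- satisfying φ has at most wd φ critical assignments.  The literals ⊤, ⊥, p, ¬p
-- are closed downwards and have none; ∼⊥, ∼p, ∼¬p assert a witness, and a
-- critical assignment must be the only witness.  For ∧, ∨ and ∨̇ the removal of s
-- from T is mirrored in both components (a (strict) split stays one), so an
-- assignment critical for the compound is critical for a component.  A neighbour
-- T ∖ {s} of A ∈ 𝔸 lying outside 𝔸 comes from a critical s, whence
-- N(A, ∁𝔸) ≤ wd φ for a defining φ.

open import Defs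
open import Data.Nat using (ℕ; zero; suc; _+_; _<_; _≤_; z≤n; s≤s)
open import Data.Nat.Properties using (≤-trans; ≤-reflexive; +-mono-≤; +-suc; m≤m+n; m≤n+m; ⊔-lub; <⇒≱)
open import Data.Nat.ListAction using (sum)
open import Data.Bool using (Bool; true; false; _∧_; _∨_; not; if_then_else_)
open import Data.Bool.Properties using (∨-zeroʳ; ∧-conicalˡ; ∧-conicalʳ; T-≡; T-∧)
import Data.Bool.Properties as Bool
open import Data.Vec using ([]; _∷_; lookup)
import Data.Vec.Properties as Vec
open import Data.Maybe using (Maybe; just; nothing)
open import Data.List using (List; []; _∷_; _++_; map; concatMap; length; find; fromMaybe; cartesianProduct)
open import Data.List.Properties using (length-++; length-map; foldr-preservesᵇ)
open import Data.List.Membership.Propositional using (_∈_; _∉_)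
open import Data.List.Membership.Propositional.Properties using (∈-map⁺; ∈-++⁺ˡ; ∈-++⁺ʳ; ∈-++⁻; ∈-∃++)
open import Data.List.Relation.Unary.Any using (here; there; satisfied; any?)
open import Data.List.Relation.Unary.Any.Properties using (any⁻)
import Data.List.Relation.Unary.All as All
import Data.List.Relation.Unary.All.Properties as All
open import Data.List.Relation.Unary.AllPairs using ([]; _∷_)
open import Data.List.Relation.Unary.Unique.Propositional using (Unique)
open import Data.List.Relation.Unary.Unique.Propositional.Properties using (cartesianProduct⁺)
open import Data.Product using (_×_; _,_; ∃-syntax; proj₁; proj₂)
open import Data.Sum using (inj₁; inj₂)
open import Data.Empty using (⊥-elim)
open import Data.Unit using (tt)
open import Function using (_∘_; _$_; Equivalence)
open import Level using (0ℓ)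
open import Relation.Unary using (Pred; Decidable; _⊆_)
open import Relation.Nullary using (¬_; Dec; yes; no)
open import Relation.Nullary.Decidable using (_×-dec_; ¬?; decidable-stable; toWitness)
open import Relation.Binary.PropositionalEquality using (_≡_; _≢_; refl; sym; trans; cong; subst; module ≡-Reasoning)

private variable
  n k m : ℕ
  X : Set

_≟ₐ_ : (s t : Assignment n) → Dec (s ≡ t)
_≟ₐ_ = Vec.≡-dec Bool._≟_

_∈ₜ?_ : (s : Assignment n) (T : Team n) → Dec (s ∈ₜ T)
s ∈ₜ? T = s ∈ᵇ T Bool.≟ true

∨-mono-true : ∀ {a b a′ b′} → (a ≡ true → a′ ≡ true) → (b ≡ true → b′ ≡ true)
            → a ∨ b ≡ true → a′ ∨ b′ ≡ true
∨-mono-true {true}         f g _ rewrite f refl = refl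
∨-mono-true {false} {true} {a′} f g _ rewrite g refl = ∨-zeroʳ a′

∈-remove-self : (s : Assignment n) (T : Team n) → s ∈ᵇ remove s T ≡ false
∈-remove-self []          b         = refl
∈-remove-self (false ∷ s) (T₀ , T₁) = ∈-remove-self s T₀
∈-remove-self (true  ∷ s) (T₀ , T₁) = ∈-remove-self s T₁

∈-remove⁻ : (s t : Assignment n) (T : Team n) → t ∈ₜ remove s T → t ∈ₜ T
∈-remove⁻ []          []          b         ()
∈-remove⁻ (false ∷ s) (false ∷ t) (T₀ , T₁) h = ∈-remove⁻ s t T₀ h
∈-remove⁻ (false ∷ s) (true  ∷ t) _         h = h
∈-remove⁻ (true  ∷ s) (false ∷ t) _         h = h
∈-remove⁻ (true  ∷ s) (true  ∷ t) (T₀ , T₁) h = ∈-remove⁻ s t T₁ h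

∈-remove⇒≢ : (s t : Assignment n) (T : Team n) → t ∈ₜ remove s T → t ≢ s
∈-remove⇒≢ s .s T h refl with () ← trans (sym h) (∈-remove-self s T)

∈-remove⁺ : (s t : Assignment n) (T : Team n) → t ∈ₜ T → t ≢ s → t ∈ₜ remove s T
∈-remove⁺ []          []          b         h t≢s = ⊥-elim (t≢s refl)
∈-remove⁺ (false ∷ s) (false ∷ t) (T₀ , T₁) h t≢s = ∈-remove⁺ s t T₀ h (t≢s ∘ cong (false ∷_))
∈-remove⁺ (false ∷ s) (true  ∷ t) _         h t≢s = h
∈-remove⁺ (true  ∷ s) (false ∷ t) _         h t≢s = h
∈-remove⁺ (true  ∷ s) (true  ∷ t) (T₀ , T₁) h t≢s = ∈-remove⁺ s t T₁ h (t≢s ∘ cong (true ∷_))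

remove-∉ : (s : Assignment n) (T : Team n) → s ∈ᵇ T ≡ false → remove s T ≡ T
remove-∉ []          false     _ = refl
remove-∉ (false ∷ s) (T₀ , T₁) h = cong (_, T₁) (remove-∉ s T₀ h)
remove-∉ (true  ∷ s) (T₀ , T₁) h = cong (T₀ ,_) (remove-∉ s T₁ h)

remove-⊆ : (s : Assignment n) {S T : Team n} → S ⊆ₜ T → remove s S ⊆ₜ remove s T
remove-⊆ s {S} {T} S⊆T t h = ∈-remove⁺ s t T (S⊆T t (∈-remove⁻ s t S h)) (∈-remove⇒≢ s t S h)

IsSplit-remove : (s : Assignment n) {T S U : Team n}
               → IsSplit T S U → IsSplit (remove s T) (remove s S) (remove s U)
IsSplit-remove s {T} {S} {U} (S⊆T , U⊆T , covers) =
  remove-⊆ s S⊆T , remove-⊆ s U⊆T , λ t h →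
    let t≢s = ∈-remove⇒≢ s t T h in
    ∨-mono-true (λ t∈S → ∈-remove⁺ s t S t∈S t≢s) (λ t∈U → ∈-remove⁺ s t U t∈U t≢s)
                (covers t (∈-remove⁻ s t T h))

IsStrictSplit-remove : (s : Assignment n) {T S U : Team n}
                     → IsStrictSplit T S U → IsStrictSplit (remove s T) (remove s S) (remove s U)
IsStrictSplit-remove s {T} {S} {U} (split , disjoint) =
  IsSplit-remove s split , λ t (t∈S , t∈U) → disjoint t (∈-remove⁻ s t S t∈S , ∈-remove⁻ s t U t∈U)

All∈ : Team n → Pred (Assignment n) 0ℓ → Set
All∈ T Q = ∀ s → s ∈ₜ T → Q s

All∈-remove : (s : Assignment n) {T : Team n} {Q : Pred (Assignment n) 0ℓ}
            → All∈ T Q → All∈ (remove s T) Q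
All∈-remove s {T} all t h = all t (∈-remove⁻ s t T h)

-- Satisfaction is not decidable here, so instead of counting the critical
-- assignments we bound them by a list that contains all of them.
Covers : List (Assignment n) → Team n → Pred (Team n) 0ℓ → Set
Covers L T P = ∀ s → s ∈ₜ T × ¬ P (remove s T) → s ∈ L

record CriticalAtMost (k : ℕ) (T : Team n) (P : Pred (Team n) 0ℓ) : Set where
  constructor criticalAtMost
  field
    candidates : List (Assignment n)
    length≤    : length candidates ≤ k
    covers     : Covers candidates T P

¬¬⇒Covers : {L : List (Assignment n)} {T : Team n} {P : Pred (Team n) 0ℓ}
          → (∀ s → s ∉ L → ¬ ¬ P (remove s T)) → Covers L T P
¬¬⇒Covers {L = L} ¬¬P s (_ , ¬P) with any? (s ≟ₐ_) L
... | yes s∈L = s∈L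
... | no  s∉L = ⊥-elim (¬¬P s s∉L ¬P)

Covers⇒¬¬ : {L : List (Assignment n)} {T : Team n} {P : Pred (Team n) 0ℓ}
            → P T → Covers L T P → ∀ s → s ∉ L → ¬ ¬ P (remove s T)
Covers⇒¬¬ {T = T} {P} PT covers s s∉L ¬P with s ∈ᵇ T in s∈ᵇT
... | true  = s∉L (covers s (s∈ᵇT , ¬P))
... | false = ¬P (subst P (sym (remove-∉ s T s∈ᵇT)) PT)

CriticalAtMost-downward : {T : Team n} {P : Pred (Team n) 0ℓ}
                        → (∀ s → P (remove s T)) → CriticalAtMost k T P
CriticalAtMost-downward P-remove = criticalAtMost [] z≤n λ s (_ , ¬P) → ⊥-elim (¬P (P-remove s))

CriticalAtMost-mono : {T : Team n} {P R : Pred (Team n) 0ℓ}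
                    → k ≤ m → P ⊆ R → CriticalAtMost k T P → CriticalAtMost m T R
CriticalAtMost-mono k≤m P⊆R (criticalAtMost L L≤k covers) =
  criticalAtMost L (≤-trans L≤k k≤m) λ s (s∈T , ¬R) → covers s (s∈T , ¬R ∘ P⊆R)

CriticalAtMost-combine : {T T₁ T₂ : Team n} {P₁ P₂ R : Pred (Team n) 0ℓ}
  → P₁ T₁ → CriticalAtMost k T₁ P₁ → P₂ T₂ → CriticalAtMost m T₂ P₂
  → (∀ s → P₁ (remove s T₁) → P₂ (remove s T₂) → R (remove s T))
  → CriticalAtMost (k + m) T R
CriticalAtMost-combine {P₁ = P₁} {P₂} {R} P₁T₁ (criticalAtMost L₁ L₁≤k covers₁)
                                          P₂T₂ (criticalAtMost L₂ L₂≤m covers₂) combine =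
  criticalAtMost (L₁ ++ L₂) (subst (_≤ _) (sym (length-++ L₁)) (+-mono-≤ L₁≤k L₂≤m)) $
  ¬¬⇒Covers {P = R} λ s s∉L ¬R →
    Covers⇒¬¬ {P = P₁} P₁T₁ covers₁ s (s∉L ∘ ∈-++⁺ˡ) λ P₁-remove →
    Covers⇒¬¬ {P = P₂} P₂T₂ covers₂ s (s∉L ∘ ∈-++⁺ʳ L₁) λ P₂-remove →
    ¬R (combine s P₁-remove P₂-remove)

length-fromMaybe : (x : Maybe X) → length (fromMaybe x) ≤ 1
length-fromMaybe (just _) = s≤s z≤n
length-fromMaybe nothing  = z≤n

∈-find-unique : {P : Pred X 0ℓ} (P? : Decidable P) {x : X} {xs : List X}
              → x ∈ xs → P x → (∀ {y} → P y → y ≡ x) → x ∈ fromMaybe (find P? xs)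
∈-find-unique P? {xs = y ∷ xs} x∈ Px unique with P? y
... | yes Py = here (sym (unique Py))
∈-find-unique P? (here refl) Px unique | no ¬Py = ⊥-elim (¬Py Px)
∈-find-unique P? (there x∈) Px unique | no ¬Py = ∈-find-unique P? x∈ Px unique

∈-allAssign : (s : Assignment n) → s ∈ allAssign n
∈-allAssign []          = here refl
∈-allAssign (false ∷ s) = ∈-++⁺ˡ (∈-map⁺ (false ∷_) (∈-allAssign s))
∈-allAssign {suc n} (true ∷ s) =
  ∈-++⁺ʳ (map (false ∷_) (allAssign n)) (∈-map⁺ (true ∷_) (∈-allAssign s))

-- A critical assignment is the only one of T violating Q.
¬All∈-criticalAtMost1 : {T : Team n} {Q : Pred (Assignment n) 0ℓ} → Decidable Q
                       → ¬ All∈ T Q → CriticalAtMost 1 T (λ U → ¬ All∈ U Q)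
¬All∈-criticalAtMost1 {n} {T} {Q} Q? ¬all =
  criticalAtMost (fromMaybe violator) (length-fromMaybe violator)
  λ s (s∈T , ¬¬all) → ∈-find-unique violates? (∈-allAssign s)
                        (s∈T , λ Qs → ¬all (all∈T s ¬¬all Qs))
                        (λ {t} (t∈T , ¬Qt) → decidable-stable (t ≟ₐ s) (¬Qt ∘ Q-elsewhere s ¬¬all t t∈T))
  where
  violates? : Decidable (λ t → t ∈ₜ T × ¬ Q t)
  violates? t = (t ∈ₜ? T) ×-dec ¬? (Q? t)

  violator : Maybe (Assignment n)
  violator = find violates? (allAssign n)

  Q-elsewhere : ∀ s → ¬ ¬ All∈ (remove s T) Q → ∀ t → t ∈ₜ T → t ≢ s → Q t
  Q-elsewhere s ¬¬all t t∈T t≢s =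
    decidable-stable (Q? t) λ ¬Qt → ¬¬all λ all → ¬Qt (all t (∈-remove⁺ s t T t∈T t≢s))

  all∈T : ∀ s → ¬ ¬ All∈ (remove s T) Q → Q s → All∈ T Q
  all∈T s ¬¬all Qs t t∈T with t ≟ₐ s
  ... | yes refl = Qs
  ... | no  t≢s  = Q-elsewhere s ¬¬all t t∈T t≢s

⊨⇒criticalAtMost-wd : (φ : Formula n) {T : Team n} → T ⊨ φ → CriticalAtMost (wd φ) T (_⊨ φ)
⊨⇒criticalAtMost-wd ⊤ᶠ       _   = CriticalAtMost-downward λ _ → tt
⊨⇒criticalAtMost-wd ⊥ᶠ       T⊨φ = CriticalAtMost-downward λ s → All∈-remove s T⊨φ
⊨⇒criticalAtMost-wd ∼⊤ᶠ      ()
⊨⇒criticalAtMost-wd ∼⊥ᶠ      T⊨φ = ¬All∈-criticalAtMost1 (λ _ → no λ ()) T⊨φ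
⊨⇒criticalAtMost-wd (var p)  T⊨φ = CriticalAtMost-downward λ s → All∈-remove s T⊨φ
⊨⇒criticalAtMost-wd (neg p)  T⊨φ = CriticalAtMost-downward λ s → All∈-remove s T⊨φ
⊨⇒criticalAtMost-wd (∼var p) T⊨φ = ¬All∈-criticalAtMost1 (λ t → lookup t p Bool.≟ true) T⊨φ
⊨⇒criticalAtMost-wd (∼neg p) T⊨φ = ¬All∈-criticalAtMost1 (λ t → lookup t p Bool.≟ false) T⊨φ
⊨⇒criticalAtMost-wd (φ ⊻ᶠ ψ) (inj₁ T⊨φ) =
  CriticalAtMost-mono (m≤m+n (wd φ) (wd ψ)) inj₁ (⊨⇒criticalAtMost-wd φ T⊨φ)
⊨⇒criticalAtMost-wd (φ ⊻ᶠ ψ) (inj₂ T⊨ψ) =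
  CriticalAtMost-mono (m≤n+m (wd ψ) (wd φ)) inj₂ (⊨⇒criticalAtMost-wd ψ T⊨ψ)
⊨⇒criticalAtMost-wd (φ ∧ᶠ ψ) (T⊨φ , T⊨ψ) =
  CriticalAtMost-combine T⊨φ (⊨⇒criticalAtMost-wd φ T⊨φ) T⊨ψ (⊨⇒criticalAtMost-wd ψ T⊨ψ)
    λ _ → _,_
⊨⇒criticalAtMost-wd (φ ∨ᶠ ψ) (S , U , split , S⊨φ , U⊨ψ) =
  CriticalAtMost-combine S⊨φ (⊨⇒criticalAtMost-wd φ S⊨φ) U⊨ψ (⊨⇒criticalAtMost-wd ψ U⊨ψ)
    λ s S′⊨φ U′⊨ψ → remove s S , remove s U , IsSplit-remove s split , S′⊨φ , U′⊨ψ
⊨⇒criticalAtMost-wd (φ ∨̇ᶠ ψ) (S , U , split , S⊨φ , U⊨ψ) =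
  CriticalAtMost-combine S⊨φ (⊨⇒criticalAtMost-wd φ S⊨φ) U⊨ψ (⊨⇒criticalAtMost-wd ψ U⊨ψ)
    λ s S′⊨φ U′⊨ψ → remove s S , remove s U , IsStrictSplit-remove s split , S′⊨φ , U′⊨ψ

∈-++-∷⇒∈-++ : {x y : X} (ys zs : List X) → y ∈ ys ++ x ∷ zs → y ≢ x → y ∈ ys ++ zs
∈-++-∷⇒∈-++ ys zs y∈ y≢x with ∈-++⁻ ys y∈
... | inj₁ y∈ys         = ∈-++⁺ˡ y∈ys
... | inj₂ (here y≡x)   = ⊥-elim (y≢x y≡x)
... | inj₂ (there y∈zs) = ∈-++⁺ʳ ys y∈zs

count≤length : (P : X → Bool) {xs : List X} (M : List X) → Unique xs
             → (∀ {x} → x ∈ xs → P x ≡ true → x ∈ M)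
             → sum (map (λ x → if P x then 1 else 0) xs) ≤ length M
count≤length P {[]}     M []               _    = z≤n
count≤length P {x ∷ xs} M (x∉xs ∷ unique) ⊆M with P x in Px
... | false = count≤length P M unique (⊆M ∘ there)
... | true with ys , zs , refl ← ∈-∃++ (⊆M (here refl) Px) =
  ≤-trans (s≤s (count≤length P (ys ++ zs) unique λ y∈xs Py →
                  ∈-++-∷⇒∈-++ ys zs (⊆M (there y∈xs) Py) (All.lookup x∉xs y∈xs ∘ sym)))
          (≤-reflexive (begin
            suc (length (ys ++ zs))      ≡⟨ cong suc (length-++ ys) ⟩
            suc (length ys + length zs)  ≡⟨ sym (+-suc (length ys) (length zs)) ⟩
            length ys + length (x ∷ zs)  ≡⟨ sym (length-++ ys) ⟩
            length (ys ++ x ∷ zs)        ∎))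
  where open ≡-Reasoning

allTeams-unique : ∀ n → Unique (allTeams n)
allTeams-unique zero    = ((λ ()) All.∷ All.[]) ∷ (All.[] ∷ [])
allTeams-unique (suc n) =
  subst Unique (sym (concatMap-pairs (allTeams n) (allTeams n)))
        (cartesianProduct⁺ (allTeams-unique n) (allTeams-unique n))
  where
  concatMap-pairs : (xs ys : List (Team n))
                  → concatMap (λ x → map (x ,_) ys) xs ≡ cartesianProduct xs ys
  concatMap-pairs []       ys = refl
  concatMap-pairs (x ∷ xs) ys = cong (map (x ,_) ys ++_) (concatMap-pairs xs ys)

isNeighbourᵇ⇒remove : (T′ A : Team n) → isNeighbourᵇ T′ A ≡ true → ∃[ s ] s ∈ₜ A × T′ ≡ remove s A
isNeighbourᵇ⇒remove {n} T′ A h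
  with s , s∈A∧T′≡ ← satisfied (any⁻ _ (allAssign n) (Equivalence.from T-≡ h))
  with s∈A , T′≡ ← Equivalence.to T-∧ s∈A∧T′≡
  = s , Equivalence.to T-≡ s∈A , toWitness T′≡

Nb≤ : {A : Team n} {P : Pred (Team n) 0ℓ} {𝔹 : TeamSet n}
    → CriticalAtMost k A P → (∀ U → 𝔹 U ≡ true → ¬ P U) → Nb A 𝔹 ≤ k
Nb≤ {n} {A = A} {𝔹 = 𝔹} (criticalAtMost L L≤k covers) 𝔹⇒¬P =
  ≤-trans (count≤length _ (map (λ s → remove s A) L) (allTeams-unique n) neighbour∈)
          (subst (_≤ _) (sym (length-map _ L)) L≤k)
  where
  neighbour∈ : ∀ {T′} → T′ ∈ allTeams n → (isNeighbourᵇ T′ A ∧ 𝔹 T′) ≡ true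
             → T′ ∈ map (λ s → remove s A) L
  neighbour∈ {T′} _ h with s , s∈A , refl ← isNeighbourᵇ⇒remove T′ A (∧-conicalˡ _ _ h) =
    ∈-map⁺ (λ s → remove s A) (covers s (s∈A , 𝔹⇒¬P T′ (∧-conicalʳ _ _ h)))

D≤ : {𝔸 𝔹 : TeamSet n} → (∀ A → 𝔸 A ≡ true → Nb A 𝔹 ≤ k) → D 𝔸 𝔹 ≤ k
D≤ {n} {k} {𝔸} {𝔹} Nb≤k =
  foldr-preservesᵇ {P = _≤ k} ⊔-lub z≤n (All.map⁺ (All.universal bounded (allTeams n)))
  where
  bounded : ∀ A → (if 𝔸 A then Nb A 𝔹 else 0) ≤ k
  bounded A with 𝔸 A in A∈𝔸
  ... | true  = Nb≤k A A∈𝔸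
  ... | false = z≤n

lemma3p9 : (n : ℕ) (𝔸 : TeamSet n) (φ : Formula n)
    → wd φ < D 𝔸 (compl 𝔸) → ¬ Defines φ 𝔸
lemma3p9 n 𝔸 φ wd<D defines = <⇒≱ wd<D (D≤ λ A A∈𝔸 →
  Nb≤ (⊨⇒criticalAtMost-wd φ (proj₂ (defines A) A∈𝔸)) outside⇒⊭)
  where
  outside⇒⊭ : ∀ U → compl 𝔸 U ≡ true → ¬ U ⊨ φ
  outside⇒⊭ U U∉𝔸 U⊨φ with () ← subst (λ b → not b ≡ true) (proj₁ (defines U) U⊨φ) U∉𝔸
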